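{- Let $G=(U,V,E)$ be a bipartite graph, $k\ge0$ an integer, and $(S,C)$ an instance with $S=(U_S,V_S)$, $C=(U_C,V_C)$. Let $u_1,\dots,u_{|U_C|}$ and $v_1,\dots,v_{|V_C|}$ be the vertices of $U_C$ and $V_C$ in ascending order of $\overline d_S(\cdot)$, and set $\overline d_S^i(U_C)=\sum_{t=1}^{i}\overline d_S(u_t)$, $\overline d_S^j(V_C)=\sum_{t=1}^{j}\overline d_S(v_t)$. For each $i\in\{0,\dots,|U_C|\}$ for which $\overline d_S^i(U_C)\le k-|\overline E_S|$, let $j_i$ be the largest $j\in\{0,\dots,|V_C|\}$ with $\overline d_S^i(U_C)+\overline d_S^{j}(V_C)\le k-|\overline E_S|$. Then every $k$-MDB $D=(U_D,V_D,E_D)$ derived from $(S,C)$ satisfies $$|E_D|\le\max_{i}\Big((|U_S|+i)(|V_S|+j_i)-|\overline E_S|-\overline d_S^i(U_C)-\overline d_S^{j_i}(V_C)\Big),$$ the maximum ranging over those $i$.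
   Context: For $S=(U_S,V_S)$ with $U_S\subseteq U$, $V_S\subseteq V$, $G(S)$ is the subgraph induced by $U_S\cup V_S$ and $\overline E_S=(U_S\times V_S)\setminus E$. For a vertex $x$ and a vertex set $X$, $\overline d_X(x)$ is the number of vertices of $X$ on the side opposite to $x$ that are not adjacent to $x$. A $k$-defective biclique is a subgraph $(U_D,V_D,E_D)$ with $|(U_D\times V_D)\setminus E_D|\le k$. An instance is a pair $(S,C)$ of disjoint vertex sets such that $G(S)$ is a $k$-defective biclique and $G(S\cup\{x\})$ is a $k$-defective biclique for every $x\in C$. A $k$-MDB derived from $(S,C)$ is a $k$-defective biclique $G(S\cup C')$ with $C'\subseteq C$ having the maximum number of edges among all $k$-defective bicliques of this form. -}

module Defs where

open import Data.Nat using (ℕ; zero; suc; _+_; _*_; _≤_)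
open import Data.Bool using (Bool; true; false; _∧_; not; if_then_else_)
open import Data.Fin using (Fin)
open import Data.Fin.Subset using (Subset; _∪_; ⁅_⁆; _⊆_; _∉_) renaming (_∈_ to _∈ₛ_)
open import Data.Vec using (lookup)
open import Data.List using (List; map; take; allFin)
open import Data.Nat.ListAction using (sum)
open import Data.List.Membership.Propositional using () renaming (_∈_ to _∈ₗ_)
open import Data.List.Relation.Unary.Unique.Propositional using (Unique)
open import Data.List.Relation.Unary.Linked using (Linked)
open import Data.Product using (_×_; Σ)

-- A bipartite graph G = (U, V, E) with U = Fin m, V = Fin n, and
-- E given by an adjacency predicate adj u v (true iff (u,v) ∈ E).
Adj : ℕ → ℕ → Set
Adj m n = Fin m → Fin n → Bool

ind : Bool → ℕ
ind true  = 1
ind false = 0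

edges : ∀ {m n} → Adj m n → Subset m → Subset n → ℕ
edges {m} {n} adj A B =
  sum (map (λ u → sum (map (λ v → ind (lookup A u ∧ lookup B v ∧ adj u v)) (allFin n))) (allFin m))

nonEdges : ∀ {m n} → Adj m n → Subset m → Subset n → ℕ
nonEdges {m} {n} adj A B =
  sum (map (λ u → sum (map (λ v → ind (lookup A u ∧ lookup B v ∧ not (adj u v))) (allFin n))) (allFin m))

dbarU : ∀ {m n} → Adj m n → Subset n → Fin m → ℕ
dbarU {m} {n} adj VS u = sum (map (λ v → ind (lookup VS v ∧ not (adj u v))) (allFin n))

dbarV : ∀ {m n} → Adj m n → Subset m → Fin n → ℕ
dbarV {m} {n} adj US v = sum (map (λ u → ind (lookup US u ∧ not (adj u v))) (allFin m))

KDefective : ∀ {m n} → Adj m n → ℕ → Subset m → Subset n → Set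
KDefective adj k A B = nonEdges adj A B ≤ k

IsInstance : ∀ {m n} → Adj m n → ℕ → Subset m → Subset n → Subset m → Subset n → Set
IsInstance adj k US VS UC VC =
  (∀ u → u ∈ₛ US → u ∉ UC) ×
  (∀ v → v ∈ₛ VS → v ∉ VC) ×
  KDefective adj k US VS ×
  (∀ u → u ∈ₛ UC → KDefective adj k (US ∪ ⁅ u ⁆) VS) ×
  (∀ v → v ∈ₛ VC → KDefective adj k US (VS ∪ ⁅ v ⁆))

-- G(S ∪ C') with C' = (U', V') ⊆ C is a k-MDB derived from (S, C)
IsKMDB : ∀ {m n} → Adj m n → ℕ → Subset m → Subset n → Subset m → Subset n →
         Subset m → Subset n → Set
IsKMDB {m} {n} adj k US VS UC VC U' V' =
  U' ⊆ UC × V' ⊆ VC × KDefective adj k (US ∪ U') (VS ∪ V') ×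
  (∀ (U'' : Subset m) (V'' : Subset n) → U'' ⊆ UC → V'' ⊆ VC →
     KDefective adj k (US ∪ U'') (VS ∪ V'') →
     edges adj (US ∪ U'') (VS ∪ V'') ≤ edges adj (US ∪ U') (VS ∪ V'))

AscendingEnum : ∀ {m} → (Fin m → ℕ) → Subset m → List (Fin m) → Set
AscendingEnum {m} f X xs =
  Unique xs × (∀ x → (x ∈ₗ xs → x ∈ₛ X) × (x ∈ₛ X → x ∈ₗ xs)) × Linked _≤_ (map f xs)

prefixSum : ∀ {m} → (Fin m → ℕ) → List (Fin m) → ℕ → ℕ
prefixSum f xs i = sum (take i (map f xs))

module Submission where

-- Take i = |U'| and j' = |V'|. In G(S ∪ C') each u ∈ U' misses d̄_S(u) vertices of
-- V_S and each v ∈ V' misses d̄_S(v) vertices of U_S; these non-edges are distinct and disjoint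
-- from Ē_S. Since the enumerations are sorted, the two sums dominate the prefix sums d̄^i(U_C) and
-- d̄^{j'}(V_C), so the budget k − |Ē_S| admits (i, j') and hence j' ≤ j_i, and
-- |E_D| = (|U_S| + i)(|V_S| + j') − |Ē_D| ≤ (|U_S| + i)(|V_S| + j') − |Ē_S| − d̄^i(U_C) − d̄^{j'}(V_C).
-- Raising j' to j_i adds (|U_S| + i)(j_i − j') vertex pairs, while every added term d̄_S(v_t) is at
-- most |U_S|, so the bound only grows.

open import Defs
open import Data.Nat using (ℕ; zero; suc; _+_; _*_; _∸_; _≤_; z≤n; s≤s; s≤s⁻¹; _≤?_)
open import Data.Nat.Properties hiding (_≟_)
open import Data.Nat.ListAction using (sum)
open import Data.Bool using (Bool; true; false; _∧_; not)
open import Data.Bool.Properties using (not-¬)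
open import Data.Fin using (Fin; zero; suc; _≟_)
open import Data.Fin.Subset using (Subset; _∪_; _⊆_; ∣_∣) renaming (_∈_ to _∈ₛ_; _∉_ to _∉ₛ_)
open import Data.Fin.Subset.Properties using (p⊆q⇒∣p∣≤∣q∣)
open import Data.Vec using ([]; _∷_; here; there; lookup)
open import Data.Vec.Properties using ([]=⇒lookup; lookup⇒[]=)
open import Data.List using (List; []; _∷_; map; take; allFin; tabulate; length)
open import Data.List.Properties using (map-tabulate; length-map)
open import Data.List.Membership.Propositional using () renaming (_∈_ to _∈ₗ_; _∉_ to _∉ₗ_)
open import Data.List.Relation.Unary.All as All using (All; []; _∷_)
open import Data.List.Relation.Unary.All.Properties using (All¬⇒¬Any; map⁺)
open import Data.List.Relation.Unary.AllPairs using (AllPairs; []; _∷_)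
open import Data.List.Relation.Unary.Any using (here; there)
open import Data.List.Relation.Unary.Linked.Properties using (Linked⇒AllPairs)
open import Data.List.Relation.Unary.Unique.Propositional using (Unique)
open import Data.Product using (_×_; _,_; proj₁; proj₂; ∃-syntax)
open import Data.Empty using (⊥-elim)
open import Function using (_∘_)
open import Relation.Binary.PropositionalEquality
open import Relation.Nullary using (does; yes; no)
open import Relation.Nullary.Decidable using (dec-true; dec-false)
open import Relation.Unary using (Decidable)
open import Algebra.Properties.CommutativeSemigroup +-commutativeSemigroup
  using (x∙yz≈y∙xz; interchange)
open import Algebra.Properties.Semiring.Sum +-*-semiring
  using (sum-syntax; sum-cong-≗; sum-replicate-zero; ∑-distrib-+; ∑-comm;
         *-distribˡ-sum; *-distribʳ-sum)

ind-∧ : ∀ a b → ind (a ∧ b) ≡ ind a * ind b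
ind-∧ false b = refl
ind-∧ true  b = sym (+-identityʳ (ind b))

ind-∧≤ : ∀ a b → ind (a ∧ b) ≤ ind a
ind-∧≤ false b     = z≤n
ind-∧≤ true  false = z≤n
ind-∧≤ true  true  = ≤-refl

ind-∧-swap : ∀ a b c → ind (a ∧ (b ∧ c)) ≡ ind b * ind (a ∧ c)
ind-∧-swap false b c = sym (*-zeroʳ (ind b))
ind-∧-swap true  b c = ind-∧ b c

ind-∧-split : ∀ a b c → ind (a ∧ (b ∧ c)) + ind (a ∧ (b ∧ not c)) ≡ ind a * ind b
ind-∧-split false b     c     = refl
ind-∧-split true  false c     = refl
ind-∧-split true  true  false = refl
ind-∧-split true  true  true  = refl

sum-tabulate : ∀ {m} (f : Fin m → ℕ) → sum (tabulate f) ≡ ∑[ i < m ] f i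
sum-tabulate {zero}  f = refl
sum-tabulate {suc m} f = cong (f zero +_) (sum-tabulate (f ∘ suc))

sum-map-allFin : ∀ {m} (f : Fin m → ℕ) → sum (map f (allFin m)) ≡ ∑[ i < m ] f i
sum-map-allFin f = trans (cong sum (map-tabulate (λ i → i) f)) (sum-tabulate f)

sum-map-allFin² : ∀ {m n} (h : Fin m → Fin n → ℕ) →
  sum (map (λ u → sum (map (h u) (allFin n))) (allFin m)) ≡ ∑[ u < m ] ∑[ v < n ] h u v
sum-map-allFin² h = trans (sum-map-allFin (λ u → sum (map (h u) (allFin _))))
  (sum-cong-≗ (λ u → sum-map-allFin (h u)))

∑-mono-≤ : ∀ {m} {f g : Fin m → ℕ} → (∀ i → f i ≤ g i) → ∑[ i < m ] f i ≤ ∑[ i < m ] g i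
∑-mono-≤ {zero}  f≤g = z≤n
∑-mono-≤ {suc m} f≤g = +-mono-≤ (f≤g zero) (∑-mono-≤ (f≤g ∘ suc))

-- Subsets as indicator vectors

𝟙 : ∀ {m} → Subset m → Fin m → ℕ
𝟙 p x = ind (lookup p x)

Disjoint : ∀ {m} → Subset m → Subset m → Set
Disjoint p q = ∀ {x} → x ∈ₛ p → x ∉ₛ q

Disjoint-⊆ : ∀ {m} {p q r : Subset m} → (∀ x → x ∈ₛ p → x ∉ₛ q) → r ⊆ q → Disjoint p r
Disjoint-⊆ p∩q≡∅ r⊆q x∈p x∈r = p∩q≡∅ _ x∈p (r⊆q x∈r)

𝟙-∪ : ∀ {m} (p q : Subset m) → Disjoint p q → ∀ x → 𝟙 (p ∪ q) x ≡ 𝟙 p x + 𝟙 q x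
𝟙-∪ (true  ∷ p) (true  ∷ q) disj zero    = ⊥-elim (disj here here)
𝟙-∪ (true  ∷ p) (false ∷ q) disj zero    = refl
𝟙-∪ (false ∷ p) (b     ∷ q) disj zero    = refl
𝟙-∪ (a     ∷ p) (b     ∷ q) disj (suc x) = 𝟙-∪ p q (λ x∈p x∈q → disj (there x∈p) (there x∈q)) x

∑-𝟙-∪ : ∀ {m} {p q : Subset m} → Disjoint p q → ∀ (g : Fin m → ℕ) →
  ∑[ x < m ] (𝟙 (p ∪ q) x * g x) ≡ ∑[ x < m ] (𝟙 p x * g x) + ∑[ x < m ] (𝟙 q x * g x)
∑-𝟙-∪ {p = p} {q} disj g = trans
  (sum-cong-≗ (λ x → trans (cong (_* g x) (𝟙-∪ p q disj x)) (*-distribʳ-+ (g x) (𝟙 p x) (𝟙 q x))))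
  (∑-distrib-+ (λ x → 𝟙 p x * g x) (λ x → 𝟙 q x * g x))

𝟙-⊆ : ∀ {m} {p q : Subset m} → p ⊆ q → ∀ x → 𝟙 p x ≡ 𝟙 q x * 𝟙 p x
𝟙-⊆ {p = p} {q} p⊆q x with lookup p x in eq
... | false = sym (*-zeroʳ (𝟙 q x))
... | true  rewrite []=⇒lookup (p⊆q (lookup⇒[]= x p eq)) = refl

∣p∣≡∑𝟙 : ∀ {m} (p : Subset m) → ∣ p ∣ ≡ ∑[ x < m ] 𝟙 p x
∣p∣≡∑𝟙 []          = refl
∣p∣≡∑𝟙 (true  ∷ p) = cong suc (∣p∣≡∑𝟙 p)
∣p∣≡∑𝟙 (false ∷ p) = ∣p∣≡∑𝟙 p

∣p∪q∣≡∣p∣+∣q∣ : ∀ {m} (p q : Subset m) → Disjoint p q → ∣ p ∪ q ∣ ≡ ∣ p ∣ + ∣ q ∣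
∣p∪q∣≡∣p∣+∣q∣ {m} p q disj = begin
  ∣ p ∪ q ∣                            ≡⟨ ∣p∣≡∑𝟙 (p ∪ q) ⟩
  ∑[ x < m ] 𝟙 (p ∪ q) x              ≡⟨ sum-cong-≗ (𝟙-∪ p q disj) ⟩
  ∑[ x < m ] (𝟙 p x + 𝟙 q x)          ≡⟨ ∑-distrib-+ (𝟙 p) (𝟙 q) ⟩
  ∑[ x < m ] 𝟙 p x + ∑[ x < m ] 𝟙 q x ≡⟨ cong₂ _+_ (∣p∣≡∑𝟙 p) (∣p∣≡∑𝟙 q) ⟨
  ∣ p ∣ + ∣ q ∣                        ∎
  where open ≡-Reasoning

-- Enumerations and prefix sums

occurrences : ∀ {m} → List (Fin m) → Fin m → ℕ
occurrences xs u = sum (map (λ x → ind (does (u ≟ x))) xs)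

∑-δ : ∀ {m} (x : Fin m) (g : Fin m → ℕ) → ∑[ u < m ] (ind (does (u ≟ x)) * g u) ≡ g x
∑-δ {suc m} zero    g =
  trans (cong₂ _+_ (+-identityʳ (g zero)) (sum-replicate-zero m)) (+-identityʳ (g zero))
∑-δ {suc m} (suc x) g = ∑-δ x (g ∘ suc)

∑-occurrences : ∀ {m} (xs : List (Fin m)) (g : Fin m → ℕ) →
  ∑[ u < m ] (occurrences xs u * g u) ≡ sum (map g xs)
∑-occurrences {m} []       g = sum-replicate-zero m
∑-occurrences {m} (x ∷ xs) g = begin
  ∑[ u < m ] ((δ u + occurrences xs u) * g u)        ≡⟨ sum-cong-≗ (λ u → *-distribʳ-+ (g u) (δ u) _) ⟩
  ∑[ u < m ] (δ u * g u + occurrences xs u * g u)    ≡⟨ ∑-distrib-+ (λ u → δ u * g u) _ ⟩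
  ∑[ u < m ] (δ u * g u) + ∑[ u < m ] (occurrences xs u * g u)
                                                     ≡⟨ cong₂ _+_ (∑-δ x g) (∑-occurrences xs g) ⟩
  g x + sum (map g xs)                               ∎
  where
  open ≡-Reasoning
  δ : Fin m → ℕ
  δ u = ind (does (u ≟ x))

occurrences-∉ : ∀ {m} {u : Fin m} xs → u ∉ₗ xs → occurrences xs u ≡ 0
occurrences-∉ []       u∉xs = refl
occurrences-∉ (x ∷ xs) u∉xs
  rewrite dec-false (_ ≟ x) (u∉xs ∘ here) = occurrences-∉ xs (u∉xs ∘ there)

occurrences-∈ : ∀ {m} {u : Fin m} {xs} → Unique xs → u ∈ₗ xs → occurrences xs u ≡ 1
occurrences-∈ {xs = x ∷ xs} (x∉xs ∷ _) (here refl)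
  rewrite dec-true (x ≟ x) refl = cong suc (occurrences-∉ xs (All¬⇒¬Any x∉xs))
occurrences-∈ {u = u} {x ∷ xs} (x∉xs ∷ xs-unique) (there u∈xs)
  rewrite dec-false (u ≟ x) (λ u≡x → All.lookup x∉xs u∈xs (sym u≡x)) = occurrences-∈ xs-unique u∈xs

∑-enumeration : ∀ {m} {X : Subset m} {xs} → Unique xs →
  (∀ x → (x ∈ₗ xs → x ∈ₛ X) × (x ∈ₛ X → x ∈ₗ xs)) →
  ∀ g → ∑[ u < m ] (𝟙 X u * g u) ≡ sum (map g xs)
∑-enumeration {m} {X} {xs} xs-unique members g =
  trans (sum-cong-≗ (λ u → cong (_* g u) (𝟙≡occurrences u))) (∑-occurrences xs g)
  where
  𝟙≡occurrences : ∀ u → 𝟙 X u ≡ occurrences xs u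
  𝟙≡occurrences u with lookup X u in eq
  ... | true  = sym (occurrences-∈ xs-unique (proj₂ (members u) (lookup⇒[]= u X eq)))
  ... | false = sym (occurrences-∉ xs λ u∈xs →
                  not-¬ eq ([]=⇒lookup (proj₁ (members u) u∈xs)))

sum-map-ind≤length : ∀ {A : Set} (w : A → Bool) xs → sum (map (λ x → ind (w x)) xs) ≤ length xs
sum-map-ind≤length w []       = z≤n
sum-map-ind≤length w (x ∷ xs) with w x
... | true  = s≤s (sum-map-ind≤length w xs)
... | false = m≤n⇒m≤1+n (sum-map-ind≤length w xs)

sum-take-cons≤ : ∀ {y : ℕ} {ys} s → All (y ≤_) ys → s ≤ length ys →
  sum (take s (y ∷ ys)) ≤ sum (take s ys)
sum-take-cons≤ zero          _               _         = z≤n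
sum-take-cons≤ (suc s)       []              ()
sum-take-cons≤ (suc zero)    (y≤z ∷ _)       _         = +-monoˡ-≤ 0 y≤z
sum-take-cons≤ {y} {z ∷ zs} (suc (suc s)) (_ ∷ y≤zs) (s≤s s<) = begin
  y + (z + sum (take s zs)) ≡⟨ x∙yz≈y∙xz y z _ ⟩
  z + (y + sum (take s zs)) ≤⟨ +-monoʳ-≤ z (sum-take-cons≤ (suc s) y≤zs s<) ⟩
  z + sum (take (suc s) zs) ∎
  where open ≤-Reasoning

sum-take-count≤sum-selected : ∀ {A : Set} (f : A → ℕ) (w : A → Bool) xs →
  AllPairs _≤_ (map f xs) →
  sum (take (sum (map (λ x → ind (w x)) xs)) (map f xs)) ≤ sum (map (λ x → ind (w x) * f x) xs)
sum-take-count≤sum-selected f w []       _               = z≤n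
sum-take-count≤sum-selected f w (x ∷ xs) (fx≤ ∷ sorted) with w x
... | true  =
  +-mono-≤ (≤-reflexive (sym (+-identityʳ (f x)))) (sum-take-count≤sum-selected f w xs sorted)
... | false = ≤-trans
  (sum-take-cons≤ (sum (map (λ x → ind (w x)) xs)) fx≤
    (≤-trans (sum-map-ind≤length w xs) (≤-reflexive (sym (length-map f xs)))))
  (sum-take-count≤sum-selected f w xs sorted)

prefixSum≤∑ : ∀ {m} {f : Fin m → ℕ} {X Y : Subset m} {xs} → AscendingEnum f X xs → Y ⊆ X →
  prefixSum f xs ∣ Y ∣ ≤ ∑[ u < m ] (𝟙 Y u * f u)
prefixSum≤∑ {m} {f} {X} {Y} {xs} (xs-unique , members , sorted) Y⊆X = begin
  sum (take ∣ Y ∣ (map f xs))                  ≡⟨ cong (λ c → sum (take c (map f xs))) ∣Y∣≡count ⟩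
  sum (take (sum (map (𝟙 Y) xs)) (map f xs))  ≤⟨ sum-take-count≤sum-selected f (lookup Y) xs
                                                   (Linked⇒AllPairs ≤-trans sorted) ⟩
  sum (map (λ x → 𝟙 Y x * f x) xs)            ≡⟨ ∑-supported (λ u → 𝟙 Y u * f u) Y*f-on-X ⟨
  ∑[ u < m ] (𝟙 Y u * f u)                     ∎
  where
  open ≤-Reasoning
  ∑-supported : ∀ h → (∀ u → h u ≡ 𝟙 X u * h u) → ∑[ u < m ] h u ≡ sum (map h xs)
  ∑-supported h h-on-X = trans (sum-cong-≗ h-on-X) (∑-enumeration xs-unique members h)
  ∣Y∣≡count : ∣ Y ∣ ≡ sum (map (𝟙 Y) xs)
  ∣Y∣≡count = trans (∣p∣≡∑𝟙 Y) (∑-supported (𝟙 Y) (𝟙-⊆ Y⊆X))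
  Y*f-on-X : ∀ u → 𝟙 Y u * f u ≡ 𝟙 X u * (𝟙 Y u * f u)
  Y*f-on-X u = trans (cong (_* f u) (𝟙-⊆ Y⊆X u)) (*-assoc (𝟙 X u) (𝟙 Y u) (f u))

sum-take≤* : ∀ {a} d {ys} → All (_≤ a) ys → sum (take d ys) ≤ d * a
sum-take≤* zero    _            = z≤n
sum-take≤* (suc d) []           = z≤n
sum-take≤* (suc d) (y≤a ∷ ys≤a) = +-mono-≤ y≤a (sum-take≤* d ys≤a)

sum-take-+≤ : ∀ {a} t d {ys} → All (_≤ a) ys → sum (take (t + d) ys) ≤ sum (take t ys) + d * a
sum-take-+≤ zero    d ys≤a                = sum-take≤* d ys≤a
sum-take-+≤ (suc t) d []                  = z≤n
sum-take-+≤ (suc t) d {y ∷ ys} (_ ∷ ys≤a) = begin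
  y + sum (take (t + d) ys)           ≤⟨ +-monoʳ-≤ y (sum-take-+≤ t d ys≤a) ⟩
  y + (sum (take t ys) + d * _)       ≡⟨ +-assoc y _ _ ⟨
  y + sum (take t ys) + d * _         ∎
  where open ≤-Reasoning

sum-take-∸≤ : ∀ {a t t'} {ys} → t ≤ t' → All (_≤ a) ys →
  sum (take t' ys) ≤ sum (take t ys) + (t' ∸ t) * a
sum-take-∸≤ {a} {t} {t'} {ys} t≤t' ys≤a =
  subst (λ s → sum (take s ys) ≤ sum (take t ys) + (t' ∸ t) * a) (m+[n∸m]≡n t≤t')
    (sum-take-+≤ t (t' ∸ t) ys≤a)

-- The A * (j ∸ j') new vertex pairs pay for the increase of the penalty, at most (j ∸ j') * a.
capacity-mono : ∀ {a A b c j' j q' q} → a ≤ A → j' ≤ j → q ≤ q' + (j ∸ j') * a →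
  A * (b + j') ∸ (c + q') ≤ A * (b + j) ∸ (c + q)
capacity-mono {a} {A} {b} {c} {j'} {j} {q'} {q} a≤A j'≤j q≤ = begin
  A * (b + j') ∸ (c + q')                      ≡⟨ [m+n]∸[m+o]≡n∸o (A * d) _ _ ⟨
  (A * d + A * (b + j')) ∸ (A * d + (c + q'))  ≤⟨ ∸-mono (≤-reflexive pairs) penalty ⟩
  A * (b + j) ∸ (c + q)                        ∎
  where
  open ≤-Reasoning
  d : ℕ
  d = j ∸ j'
  pairs : A * d + A * (b + j') ≡ A * (b + j)
  pairs = begin-equality
    A * d + A * (b + j')  ≡⟨ *-distribˡ-+ A d (b + j') ⟨
    A * (d + (b + j'))    ≡⟨ cong (A *_) (trans (+-comm d (b + j')) (+-assoc b j' d)) ⟩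
    A * (b + (j' + d))    ≡⟨ cong (λ t → A * (b + t)) (m+[n∸m]≡n j'≤j) ⟩
    A * (b + j)           ∎
  penalty : c + q ≤ A * d + (c + q')
  penalty = begin
    c + q                 ≤⟨ +-monoʳ-≤ c q≤ ⟩
    c + (q' + d * a)      ≤⟨ +-monoʳ-≤ c (+-monoʳ-≤ q' (*-monoʳ-≤ d a≤A)) ⟩
    c + (q' + d * A)      ≡⟨ cong (λ t → c + (q' + t)) (*-comm d A) ⟩
    c + (q' + A * d)      ≡⟨ +-assoc c q' (A * d) ⟨
    c + q' + A * d        ≡⟨ +-comm (c + q') (A * d) ⟩
    A * d + (c + q')      ∎

greatest : ∀ {P : ℕ → Set} → Decidable P → ∀ bound {a} → a ≤ bound → P a →
  ∃[ j ] (a ≤ j × j ≤ bound × P j × (∀ j' → j' ≤ bound → P j' → j' ≤ j))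
greatest P? zero        z≤n Pa = zero , z≤n , z≤n , Pa , λ _ j'≤0 _ → j'≤0
greatest {P} P? (suc bound) a≤ Pa with P? (suc bound)
... | yes Pb = suc bound , a≤ , ≤-refl , Pb , λ _ j'≤b _ → j'≤b
... | no ¬Pb =
  let j , a≤j , j≤ , Pj , maximal = greatest P? bound (below a≤ Pa) Pa
  in  j , a≤j , m≤n⇒m≤1+n j≤ , Pj , λ j' j'≤ Pj' → maximal j' (below j'≤ Pj') Pj'
  where
  below : ∀ {x} → x ≤ suc bound → P x → x ≤ bound
  below x≤ Px = s≤s⁻¹ (≤∧≢⇒< x≤ λ x≡b → ¬Pb (subst P x≡b Px))

-- Non-edges of extensions of S

module _ {m n} (adj : Adj m n) where

  nonEdges≡∑dbarU : ∀ A B → nonEdges adj A B ≡ ∑[ u < m ] (𝟙 A u * dbarU adj B u)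
  nonEdges≡∑dbarU A B = begin
    nonEdges adj A B
      ≡⟨ sum-map-allFin² (λ u v → ind (lookup A u ∧ h u v)) ⟩
    ∑[ u < m ] ∑[ v < n ] ind (lookup A u ∧ h u v)
      ≡⟨ sum-cong-≗ (λ u → sum-cong-≗ (λ v → ind-∧ (lookup A u) (h u v))) ⟩
    ∑[ u < m ] ∑[ v < n ] (𝟙 A u * ind (h u v))
      ≡⟨ sum-cong-≗ (λ u → *-distribˡ-sum (𝟙 A u) (λ v → ind (h u v))) ⟨
    ∑[ u < m ] (𝟙 A u * ∑[ v < n ] ind (h u v))
      ≡⟨ sum-cong-≗ (λ u → cong (𝟙 A u *_) (sum-map-allFin (λ v → ind (h u v)))) ⟨
    ∑[ u < m ] (𝟙 A u * dbarU adj B u)        ∎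
    where
    open ≡-Reasoning
    h : Fin m → Fin n → Bool
    h u v = lookup B v ∧ not (adj u v)

  nonEdges≡∑dbarV : ∀ A B → nonEdges adj A B ≡ ∑[ v < n ] (𝟙 B v * dbarV adj A v)
  nonEdges≡∑dbarV A B = begin
    nonEdges adj A B
      ≡⟨ sum-map-allFin² (λ u v → ind (lookup A u ∧ (lookup B v ∧ c u v))) ⟩
    ∑[ u < m ] ∑[ v < n ] ind (lookup A u ∧ (lookup B v ∧ c u v))
      ≡⟨ ∑-comm (λ u v → ind (lookup A u ∧ (lookup B v ∧ c u v))) ⟩
    ∑[ v < n ] ∑[ u < m ] ind (lookup A u ∧ (lookup B v ∧ c u v))
      ≡⟨ sum-cong-≗ (λ v → sum-cong-≗ (λ u → ind-∧-swap (lookup A u) (lookup B v) (c u v))) ⟩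
    ∑[ v < n ] ∑[ u < m ] (𝟙 B v * ind (lookup A u ∧ c u v))
      ≡⟨ sum-cong-≗ (λ v → *-distribˡ-sum (𝟙 B v) (λ u → ind (lookup A u ∧ c u v))) ⟨
    ∑[ v < n ] (𝟙 B v * ∑[ u < m ] ind (lookup A u ∧ c u v))
      ≡⟨ sum-cong-≗ (λ v → cong (𝟙 B v *_) (sum-map-allFin (λ u → ind (lookup A u ∧ c u v)))) ⟨
    ∑[ v < n ] (𝟙 B v * dbarV adj A v)        ∎
    where
    open ≡-Reasoning
    c : Fin m → Fin n → Bool
    c u v = not (adj u v)

  edges+nonEdges≡∣A∣*∣B∣ : ∀ A B → edges adj A B + nonEdges adj A B ≡ ∣ A ∣ * ∣ B ∣
  edges+nonEdges≡∣A∣*∣B∣ A B = begin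
    edges adj A B + nonEdges adj A B
      ≡⟨ cong₂ _+_ (sum-map-allFin² (λ u v → e u v (adj u v)))
                   (sum-map-allFin² (λ u v → e u v (not (adj u v)))) ⟩
    ∑[ u < m ] ∑[ v < n ] e u v (adj u v) + ∑[ u < m ] ∑[ v < n ] e u v (not (adj u v))
      ≡⟨ ∑-distrib-+ (λ u → ∑[ v < n ] e u v (adj u v)) _ ⟨
    ∑[ u < m ] (∑[ v < n ] e u v (adj u v) + ∑[ v < n ] e u v (not (adj u v)))
      ≡⟨ sum-cong-≗ (λ u → ∑-distrib-+ (λ v → e u v (adj u v)) _) ⟨
    ∑[ u < m ] ∑[ v < n ] (e u v (adj u v) + e u v (not (adj u v)))
      ≡⟨ sum-cong-≗ (λ u → sum-cong-≗ (λ v → ind-∧-split (lookup A u) (lookup B v) (adj u v))) ⟩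
    ∑[ u < m ] ∑[ v < n ] (𝟙 A u * 𝟙 B v)
      ≡⟨ sum-cong-≗ (λ u → *-distribˡ-sum (𝟙 A u) (𝟙 B)) ⟨
    ∑[ u < m ] (𝟙 A u * ∑[ v < n ] 𝟙 B v)
      ≡⟨ *-distribʳ-sum (∑[ v < n ] 𝟙 B v) (𝟙 A) ⟨
    ∑[ u < m ] 𝟙 A u * ∑[ v < n ] 𝟙 B v
      ≡⟨ cong₂ _*_ (∣p∣≡∑𝟙 A) (∣p∣≡∑𝟙 B) ⟨
    ∣ A ∣ * ∣ B ∣                             ∎
    where
    open ≡-Reasoning
    e : Fin m → Fin n → Bool → ℕ
    e u v c = ind (lookup A u ∧ (lookup B v ∧ c))

  nonEdges-∪ˡ : ∀ {A A'} B → Disjoint A A' →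
    nonEdges adj (A ∪ A') B ≡ nonEdges adj A B + nonEdges adj A' B
  nonEdges-∪ˡ {A} {A'} B disj = begin
    nonEdges adj (A ∪ A') B                        ≡⟨ nonEdges≡∑dbarU (A ∪ A') B ⟩
    ∑[ u < m ] (𝟙 (A ∪ A') u * dbarU adj B u)     ≡⟨ ∑-𝟙-∪ disj (dbarU adj B) ⟩
    ∑[ u < m ] (𝟙 A u * dbarU adj B u) + ∑[ u < m ] (𝟙 A' u * dbarU adj B u)
      ≡⟨ cong₂ _+_ (nonEdges≡∑dbarU A B) (nonEdges≡∑dbarU A' B) ⟨
    nonEdges adj A B + nonEdges adj A' B           ∎
    where open ≡-Reasoning

  nonEdges-∪ʳ : ∀ A {B B'} → Disjoint B B' →
    nonEdges adj A (B ∪ B') ≡ nonEdges adj A B + nonEdges adj A B'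
  nonEdges-∪ʳ A {B} {B'} disj = begin
    nonEdges adj A (B ∪ B')                        ≡⟨ nonEdges≡∑dbarV A (B ∪ B') ⟩
    ∑[ v < n ] (𝟙 (B ∪ B') v * dbarV adj A v)     ≡⟨ ∑-𝟙-∪ disj (dbarV adj A) ⟩
    ∑[ v < n ] (𝟙 B v * dbarV adj A v) + ∑[ v < n ] (𝟙 B' v * dbarV adj A v)
      ≡⟨ cong₂ _+_ (nonEdges≡∑dbarV A B) (nonEdges≡∑dbarV A B') ⟨
    nonEdges adj A B + nonEdges adj A B'           ∎
    where open ≡-Reasoning

  nonEdges-∪-∪ : ∀ {A A' B B'} → Disjoint A A' → Disjoint B B' →
    nonEdges adj A B + nonEdges adj A' B + nonEdges adj A B' ≤ nonEdges adj (A ∪ A') (B ∪ B')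
  nonEdges-∪-∪ {A} {A'} {B} {B'} disjA disjB = begin
    x + y + z                           ≤⟨ m≤m+n (x + y + z) w ⟩
    x + y + z + w                       ≡⟨ +-assoc (x + y) z w ⟩
    (x + y) + (z + w)                   ≡⟨ interchange x y z w ⟩
    (x + z) + (y + w)                   ≡⟨ cong₂ _+_ (nonEdges-∪ʳ A disjB) (nonEdges-∪ʳ A' disjB) ⟨
    nonEdges adj A (B ∪ B') + nonEdges adj A' (B ∪ B')
                                        ≡⟨ nonEdges-∪ˡ (B ∪ B') disjA ⟨
    nonEdges adj (A ∪ A') (B ∪ B')      ∎
    where
    open ≤-Reasoning
    x y z w : ℕ
    x = nonEdges adj A B
    y = nonEdges adj A' B
    z = nonEdges adj A B'
    w = nonEdges adj A' B'

  dbarV≤∣A∣ : ∀ A v → dbarV adj A v ≤ ∣ A ∣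
  dbarV≤∣A∣ A v = begin
    dbarV adj A v                                ≡⟨ sum-map-allFin (λ u → ind (lookup A u ∧ not (adj u v))) ⟩
    ∑[ u < m ] ind (lookup A u ∧ not (adj u v))  ≤⟨ ∑-mono-≤ (λ u → ind-∧≤ (lookup A u) _) ⟩
    ∑[ u < m ] 𝟙 A u                             ≡⟨ ∣p∣≡∑𝟙 A ⟨
    ∣ A ∣                                        ∎
    where open ≤-Reasoning

  edges+nonEdges-∪ : ∀ {A A' B B'} → Disjoint A A' → Disjoint B B' →
    edges adj (A ∪ A') (B ∪ B') + nonEdges adj (A ∪ A') (B ∪ B')
      ≡ (∣ A ∣ + ∣ A' ∣) * (∣ B ∣ + ∣ B' ∣)
  edges+nonEdges-∪ {A} {A'} {B} {B'} disjA disjB =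
    trans (edges+nonEdges≡∣A∣*∣B∣ (A ∪ A') (B ∪ B'))
          (cong₂ _*_ (∣p∪q∣≡∣p∣+∣q∣ A A' disjA) (∣p∪q∣≡∣p∣+∣q∣ B B' disjB))

  nonEdges+prefixSums≤nonEdges-∪ : ∀ {US UC U' : Subset m} {VS VC V' : Subset n} {us vs} →
    Disjoint US U' → Disjoint VS V' → U' ⊆ UC → V' ⊆ VC →
    AscendingEnum (dbarU adj VS) UC us → AscendingEnum (dbarV adj US) VC vs →
    nonEdges adj US VS + prefixSum (dbarU adj VS) us ∣ U' ∣ + prefixSum (dbarV adj US) vs ∣ V' ∣
      ≤ nonEdges adj (US ∪ U') (VS ∪ V')
  nonEdges+prefixSums≤nonEdges-∪ {US} {UC} {U'} {VS} {VC} {V'} {us} {vs}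
    disjU disjV U'⊆UC V'⊆VC us-enum vs-enum =
    ≤-trans (+-mono-≤ (+-monoʳ-≤ (nonEdges adj US VS) prefixU≤) prefixV≤) (nonEdges-∪-∪ disjU disjV)
    where
    prefixU≤ : prefixSum (dbarU adj VS) us ∣ U' ∣ ≤ nonEdges adj U' VS
    prefixU≤ = ≤-trans (prefixSum≤∑ us-enum U'⊆UC) (≤-reflexive (sym (nonEdges≡∑dbarU U' VS)))
    prefixV≤ : prefixSum (dbarV adj US) vs ∣ V' ∣ ≤ nonEdges adj US V'
    prefixV≤ = ≤-trans (prefixSum≤∑ vs-enum V'⊆VC) (≤-reflexive (sym (nonEdges≡∑dbarV US V')))

mainTheorem11 : ∀ {m n} (adj : Adj m n) (k : ℕ)
    (US UC : Subset m) (VS VC : Subset n) →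
    IsInstance adj k US VS UC VC →
    (us : List _) → AscendingEnum (dbarU adj VS) UC us →
    (vs : List _) → AscendingEnum (dbarV adj US) VC vs →
    (U' : Subset m) (V' : Subset n) → IsKMDB adj k US VS UC VC U' V' →
    ∃[ i ] ∃[ j ]
      (i ≤ ∣ UC ∣ × prefixSum (dbarU adj VS) us i ≤ k ∸ nonEdges adj US VS ×
       j ≤ ∣ VC ∣ ×
       prefixSum (dbarU adj VS) us i + prefixSum (dbarV adj US) vs j ≤ k ∸ nonEdges adj US VS ×
       (∀ j' → j' ≤ ∣ VC ∣ →
         prefixSum (dbarU adj VS) us i + prefixSum (dbarV adj US) vs j' ≤ k ∸ nonEdges adj US VS →
         j' ≤ j) ×
       edges adj (US ∪ U') (VS ∪ V') ≤
         (∣ US ∣ + i) * (∣ VS ∣ + j) ∸ nonEdges adj US VS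
           ∸ prefixSum (dbarU adj VS) us i ∸ prefixSum (dbarV adj US) vs j)
mainTheorem11 adj k US UC VS VC (US∉UC , VS∉VC , _) us us-enum vs vs-enum U' V'
  (U'⊆UC , V'⊆VC , defective , _) =
  let j , ∣V'∣≤j , j≤∣VC∣ , fits-j , j-greatest =
        greatest (λ t → P + Q t ≤? K) ∣ VC ∣ (p⊆q⇒∣p∣≤∣q∣ V'⊆VC) fits
  in  ∣ U' ∣ , j , p⊆q⇒∣p∣≤∣q∣ U'⊆UC , m+n≤o⇒m≤o P fits-j , j≤∣VC∣ , fits-j , j-greatest ,
      edges≤ ∣V'∣≤j
  where
  E K P : ℕ
  E = nonEdges adj US VS
  K = k ∸ E
  P = prefixSum (dbarU adj VS) us ∣ U' ∣
  Q : ℕ → ℕ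
  Q = prefixSum (dbarV adj US) vs
  disjU : Disjoint US U'
  disjU = Disjoint-⊆ US∉UC U'⊆UC
  disjV : Disjoint VS V'
  disjV = Disjoint-⊆ VS∉VC V'⊆VC
  penalty : E + P + Q ∣ V' ∣ ≤ nonEdges adj (US ∪ U') (VS ∪ V')
  penalty = nonEdges+prefixSums≤nonEdges-∪ adj disjU disjV U'⊆UC V'⊆VC us-enum vs-enum
  fits : P + Q ∣ V' ∣ ≤ K
  fits = m+n≤o⇒m≤o∸n (P + Q ∣ V' ∣)
    (subst (_≤ k) (trans (+-assoc E P _) (+-comm E _)) (≤-trans penalty defective))
  edges≤ : ∀ {j} → ∣ V' ∣ ≤ j →
    edges adj (US ∪ U') (VS ∪ V') ≤ (∣ US ∣ + ∣ U' ∣) * (∣ VS ∣ + j) ∸ E ∸ P ∸ Q j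
  edges≤ {j} ∣V'∣≤j = begin
    edges adj (US ∪ U') (VS ∪ V')
      ≤⟨ m+n≤o⇒m≤o∸n _
           (≤-trans (+-monoʳ-≤ _ penalty) (≤-reflexive (edges+nonEdges-∪ adj disjU disjV))) ⟩
    (∣ US ∣ + ∣ U' ∣) * (∣ VS ∣ + ∣ V' ∣) ∸ (E + P + Q ∣ V' ∣)
      ≤⟨ capacity-mono {b = ∣ VS ∣} {c = E + P} (m≤m+n ∣ US ∣ ∣ U' ∣) ∣V'∣≤j
           (sum-take-∸≤ ∣V'∣≤j (map⁺ (All.universal (dbarV≤∣A∣ adj US) vs))) ⟩
    (∣ US ∣ + ∣ U' ∣) * (∣ VS ∣ + j) ∸ (E + P + Q j)
      ≡⟨ trans (cong (_∸ Q j) (∸-+-assoc _ E P)) (∸-+-assoc _ (E + P) (Q j)) ⟨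
    (∣ US ∣ + ∣ U' ∣) * (∣ VS ∣ + j) ∸ E ∸ P ∸ Q j ∎
    where open ≤-Reasoning
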